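{- There exist a constant $c>0$ and an infinite family of texts $T$ of unbounded lengths such that $N(T)\ge c\,|T|$; that is, in the worst case $N\in\Omega(n)$, where $n=|T|$. (Concretely, for the Fibonacci words, $N(F_i)\ge f_i-2=|F_i|-2$ for $i\ge 7$.)
   Context: For a text $T$ of length $n$, with $f(W)$ the number of occurrences of $W$ in $T$, an occurrence $(s,e)$ is a net occurrence if $f(T[s\ldots e])\ge 2$, $f(T[s-1\ldots e])=1$ and $f(T[s\ldots e+1])=1$, where the second condition is considered true when $s=1$ and the third when $e=n$. $\phi(S)$ is the number of net occurrences of $S$. $\mathcal{S}(T)$ is the set of substrings $S$ of $T$ with $\phi(S)>0$, and $N(T)=\sum_{S\in\mathcal{S}(T)}|S|$. Fibonacci words: $F_1=\texttt{b}$, $F_2=\texttt{a}$, $F_i=F_{i-1}F_{i-2}$; $f_i=|F_i|$. -}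

module Defs where

open import Data.Bool using (Bool; true; false; _∧_; _∨_; if_then_else_)
open import Data.Nat using (ℕ; zero; suc; _+_; _∸_; _≡ᵇ_; _≤ᵇ_)
open import Data.List using (List; []; _∷_; _++_; length; take; drop; filter; map; upTo; concatMap; deduplicate)
open import Data.List.Properties using (≡-dec)
open import Data.Nat.ListAction using (sum)
open import Data.Product using (_×_; _,_)
open import Relation.Binary.PropositionalEquality using (_≡_; refl)
open import Relation.Nullary using (yes; no)
open import Relation.Nullary.Decidable using (does)

data Sym : Set where
  a b : Sym

_≟S_ : (x y : Sym) → Relation.Nullary.Dec (x ≡ y)
a ≟S a = yes refl
a ≟S b = no (λ ())
b ≟S a = no (λ ())
b ≟S b = yes refl

Text : Set
Text = List Sym

isPrefix : Text → Text → Bool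
isPrefix [] _ = true
isPrefix (_ ∷ _) [] = false
isPrefix (x ∷ xs) (y ∷ ys) = does (x ≟S y) ∧ isPrefix xs ys

occ : Text → Text → ℕ
occ T W = length (filter (λ i → Data.Bool._≟_ (isPrefix W (drop i T)) true) (upTo (length T)))

-- T[s..e] with 0-based inclusive positions s ≤ e
substr : Text → ℕ → ℕ → Text
substr T s e = take (suc e ∸ s) (drop s T)

isNet : Text → ℕ → ℕ → Bool
isNet T s e =
  (2 ≤ᵇ occ T (substr T s e))
  ∧ (leftOK s)
  ∧ ((suc e ≡ᵇ length T) ∨ (occ T (substr T s (suc e)) ≡ᵇ 1))
  where
  leftOK : ℕ → Bool
  leftOK zero = true
  leftOK (suc s') = occ T (substr T s' e) ≡ᵇ 1

netOccs : Text → List (ℕ × ℕ)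
netOccs T =
  concatMap (λ s → concatMap (λ e → if (s ≤ᵇ e) ∧ isNet T s e then (s , e) ∷ [] else [])
                               (upTo (length T)))
            (upTo (length T))

netStrings : Text → List Text
netStrings T = deduplicate (≡-dec _≟S_) (map (λ p → substr T (Data.Product.proj₁ p) (Data.Product.proj₂ p)) (netOccs T))

N : Text → ℕ
N T = sum (map length (netStrings T))

-- Fibonacci words: F 1 = b, F 2 = a, F (i) = F (i-1) F (i-2); F 0 unused
F : ℕ → Text
F zero = []
F (suc zero) = b ∷ []
F (suc (suc zero)) = a ∷ []
F (suc (suc (suc n))) = F (suc (suc n)) ++ F (suc n)

{-# OPTIONS --safe #-}
-- Write F(j+7) = U B with U = F(j+6) = r c d and B = F(j+5). Since F(j+5) F(j+4) and
-- F(j+4) F(j+5) differ only by swapping their last two letters, F(j+7) = B r y x, so the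
-- prefix r occurs again right after the border B. The prefix r c occurs only at the start:
-- this property of (F(k), F(k+1)) is carried to (F(k+1), F(k+2)) by the Fibonacci morphism
-- φ : a ↦ ab, b ↦ a, because the blocks of a φ-image are exactly the factors starting at an a.
-- Hence r is a net string. The suffix B is repeated (it is also a prefix); extending it to the
-- left while it stays repeated yields a net suffix S with |S| ≥ |B|. Finally S ≠ r, for S = r
-- would give r period 2 while r starts with abaa, and so N ≥ |r| + |B| = |F(j+7)| - 2.
module Submission where

open import Defs
open import Data.Nat using (ℕ; _*_; _∸_; _≤_; _<_)
open import Data.List using (length)
open import Data.Product using (Σ; _×_; ∃)

open import Data.Bool using (true; _∧_; if_then_else_)
import Data.Bool as Bool
open import Data.Bool.Properties using (T-≡; T-∧; T-∨)
open import Data.List using (List; []; _∷_; _++_; take; drop; filter; map; upTo; applyUpTo)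
open import Data.List.Properties
  using (++-assoc; ++-identityʳ; ∷-injectiveʳ; ∷ʳ-injectiveˡ; ∷ʳ-++; length-++; length-++-≤ˡ;
         length-drop; take++drop≡id; drop-drop; take-all; filter-accept; filter-none; ≡-dec)
open import Data.List.Membership.Propositional using (_∈_; lose)
open import Data.List.Membership.Propositional.Properties
  using (∈-length; ∈-filter⁺; ∈-upTo⁺; ∈-map⁺; ∈-concatMap⁺; ∈-deduplicate⁺)
open import Data.List.Relation.Unary.Any using (here; there)
open import Data.List.Relation.Unary.All using (All)
open import Data.List.Relation.Unary.All.Properties using (applyUpTo⁺₁)
open import Data.Nat using (zero; suc; _+_; _≤ᵇ_; z≤n; s≤s; s≤s⁻¹; z<s; s<s; _≟_)
open import Data.Nat.ListAction using (sum)
open import Data.Nat.Properties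
open import Data.Product using (_,_; proj₁; proj₂; ∃-syntax)
open import Data.Sum using (_⊎_; inj₁; inj₂)
import Data.Sum as Sum
open import Function using (_∘_; Equivalence)
open import Relation.Nullary using (¬_; Dec; yes; no; contradiction)
open import Relation.Binary.PropositionalEquality

open Equivalence using (to; from)

module _ {A : Set} where

  take-length-++ : ∀ (x y : List A) → take (length x) (x ++ y) ≡ x
  take-length-++ []      y = refl
  take-length-++ (z ∷ x) y = cong (z ∷_) (take-length-++ x y)

  take-suc-length-++ : ∀ (x : List A) c y → take (suc (length x)) (x ++ c ∷ y) ≡ x ++ c ∷ []
  take-suc-length-++ []      c y = refl
  take-suc-length-++ (z ∷ x) c y = cong (z ∷_) (take-suc-length-++ x c y)

  drop-length-++ : ∀ (x y : List A) → drop (length x) (x ++ y) ≡ y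
  drop-length-++ []      y = refl
  drop-length-++ (_ ∷ x) y = drop-length-++ x y

  length-<-++ : ∀ (x : List A) w₀ w → length x < length (x ++ w₀ ∷ w)
  length-<-++ []      w₀ w = z<s
  length-<-++ (_ ∷ x) w₀ w = s<s (length-<-++ x w₀ w)

  ++-∷-∷-injectiveˡ : ∀ (x y : List A) {p q p′ q′} → x ++ p ∷ q ∷ [] ≡ y ++ p′ ∷ q′ ∷ [] → x ≡ y
  ++-∷-∷-injectiveˡ x y {p} {q} {p′} {q′} eq =
    ∷ʳ-injectiveˡ x y (∷ʳ-injectiveˡ (x ++ p ∷ []) (y ++ p′ ∷ [])
      (trans (∷ʳ-++ x p (q ∷ [])) (trans eq (sym (∷ʳ-++ y p′ (q′ ∷ []))))))

  drop-≡⇒periodic : ∀ {t} (x r v : List A) s → t ≡ x ++ r ++ v → s ≤ length t → r ≡ drop s t →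
                    r ≡ drop (length v) (r ++ v)
  drop-≡⇒periodic x r v s refl s≤ r≡ = begin
    r                                                ≡⟨ r≡ ⟩
    drop s (x ++ r ++ v)                             ≡⟨ cong (λ n → drop n (x ++ r ++ v)) s≡ ⟩
    drop (length x + length v) (x ++ r ++ v)         ≡⟨ drop-drop (length x) (length v) _ ⟨
    drop (length v) (drop (length x) (x ++ r ++ v))  ≡⟨ cong (drop (length v)) (drop-length-++ x _) ⟩
    drop (length v) (r ++ v)                         ∎
    where
    open ≡-Reasoning
    s≡ : s ≡ length x + length v
    s≡ = +-cancelʳ-≡ (length r) s (length x + length v) (begin
      s + length r                          ≡⟨ cong (λ w → s + length w) r≡ ⟩
      s + length (drop s (x ++ r ++ v))     ≡⟨ cong (s +_) (length-drop s (x ++ r ++ v)) ⟩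
      s + (length (x ++ r ++ v) ∸ s)        ≡⟨ m+[n∸m]≡n s≤ ⟩
      length (x ++ r ++ v)                  ≡⟨ length-++ x ⟩
      length x + length (r ++ v)            ≡⟨ cong (length x +_) (trans (length-++ r) (+-comm (length r) _)) ⟩
      length x + (length v + length r)      ≡⟨ +-assoc (length x) (length v) (length r) ⟨
      length x + length v + length r        ∎)

  ∈-∈-≢⇒2≤length : ∀ {x y : A} {xs} → x ∈ xs → y ∈ xs → x ≢ y → 2 ≤ length xs
  ∈-∈-≢⇒2≤length (here refl) (here refl) x≢y = contradiction refl x≢y
  ∈-∈-≢⇒2≤length (here _)    (there y∈)  _   = s≤s (∈-length y∈)
  ∈-∈-≢⇒2≤length (there x∈)  (here _)    _   = s≤s (∈-length x∈)
  ∈-∈-≢⇒2≤length (there x∈)  (there y∈)  x≢y = m≤n⇒m≤1+n (∈-∈-≢⇒2≤length x∈ y∈ x≢y)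

  ∈⇒≤sum-map : (f : A → ℕ) {x : A} {xs : List A} → x ∈ xs → f x ≤ sum (map f xs)
  ∈⇒≤sum-map f (here refl) = m≤m+n _ _
  ∈⇒≤sum-map f {xs = z ∷ _} (there x∈) = ≤-trans (∈⇒≤sum-map f x∈) (m≤n+m _ (f z))

  ∈-∈-≢⇒+≤sum-map : (f : A → ℕ) {x y : A} {xs : List A} →
                    x ∈ xs → y ∈ xs → x ≢ y → f x + f y ≤ sum (map f xs)
  ∈-∈-≢⇒+≤sum-map f (here refl) (here refl) x≢y = contradiction refl x≢y
  ∈-∈-≢⇒+≤sum-map f {x} (here refl) (there y∈) _ = +-monoʳ-≤ (f x) (∈⇒≤sum-map f y∈)
  ∈-∈-≢⇒+≤sum-map f {x} {y} {_ ∷ xs} (there x∈) (here refl) _ =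
    subst (_≤ f y + sum (map f xs)) (+-comm (f y) (f x)) (+-monoʳ-≤ (f y) (∈⇒≤sum-map f x∈))
  ∈-∈-≢⇒+≤sum-map f {xs = z ∷ _} (there x∈) (there y∈) x≢y =
    ≤-trans (∈-∈-≢⇒+≤sum-map f x∈ y∈ x≢y) (m≤n+m _ (f z))

OccursAt : Text → Text → ℕ → Set
OccursAt t w i = isPrefix w (drop i t) ≡ true

occursAt? : ∀ t w i → Dec (OccursAt t w i)
occursAt? t w i = isPrefix w (drop i t) Bool.≟ true

positions : Text → Text → List ℕ
positions t w = filter (occursAt? t w) (upTo (length t))

OnlyAtStart : Text → Text → Set
OnlyAtStart t w = ∀ x y → t ≡ x ++ w ++ y → x ≡ []

isPrefix-++ : ∀ w y → isPrefix w (w ++ y) ≡ true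
isPrefix-++ []      y = refl
isPrefix-++ (a ∷ w) y = isPrefix-++ w y
isPrefix-++ (b ∷ w) y = isPrefix-++ w y

isPrefix-refl : ∀ w → isPrefix w w ≡ true
isPrefix-refl w = subst (λ s → isPrefix w s ≡ true) (++-identityʳ w) (isPrefix-++ w [])

isPrefix⇒++ : ∀ w s → isPrefix w s ≡ true → ∃[ y ] s ≡ w ++ y
isPrefix⇒++ []      s       _ = s , refl
isPrefix⇒++ (_ ∷ _) []      ()
isPrefix⇒++ (x ∷ w) (z ∷ s) h with x ≟S z
... | yes refl = let y , s≡ = isPrefix⇒++ w s h in y , cong (x ∷_) s≡
... | no _ with () ← h

occursAt-++ : ∀ x w y → OccursAt (x ++ w ++ y) w (length x)
occursAt-++ x w y = trans (cong (isPrefix w) (drop-length-++ x (w ++ y))) (isPrefix-++ w y)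

occursAt⇒split : ∀ t w i → OccursAt t w i → ∃[ y ] t ≡ take i t ++ w ++ y
occursAt⇒split t w i occurs =
  let y , drop≡ = isPrefix⇒++ w (drop i t) occurs
  in  y , trans (sym (take++drop≡id i t)) (cong (take i t ++_) drop≡)

occurrence∈positions : ∀ {t} x w₀ w y → t ≡ x ++ (w₀ ∷ w) ++ y → length x ∈ positions t (w₀ ∷ w)
occurrence∈positions x w₀ w y refl =
  ∈-filter⁺ (occursAt? (x ++ (w₀ ∷ w) ++ y) (w₀ ∷ w)) (∈-upTo⁺ (length-<-++ x w₀ (w ++ y)))
    (occursAt-++ x (w₀ ∷ w) y)

2≤occ : ∀ {t w₀ w} x₁ y₁ x₂ y₂ → t ≡ x₁ ++ (w₀ ∷ w) ++ y₁ → t ≡ x₂ ++ (w₀ ∷ w) ++ y₂ →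
        length x₁ ≢ length x₂ → 2 ≤ occ t (w₀ ∷ w)
2≤occ x₁ y₁ x₂ y₂ t≡₁ t≡₂ =
  ∈-∈-≢⇒2≤length (occurrence∈positions x₁ _ _ y₁ t≡₁) (occurrence∈positions x₂ _ _ y₂ t≡₂)

1≤occ-suffix : ∀ t s → s < length t → 1 ≤ occ t (drop s t)
1≤occ-suffix t s s< = ∈-length (∈-filter⁺ (occursAt? t (drop s t)) (∈-upTo⁺ s<) (isPrefix-refl (drop s t)))

occ≡1 : ∀ {t w₀ w} y → t ≡ (w₀ ∷ w) ++ y → OnlyAtStart t (w₀ ∷ w) → occ t (w₀ ∷ w) ≡ 1
occ≡1 {t} {w₀} {w} y refl only = begin
  length (filter P? (0 ∷ later))  ≡⟨ cong length (filter-accept P? {x = 0} {xs = later} (isPrefix-++ (w₀ ∷ w) y)) ⟩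
  suc (length (filter P? later))  ≡⟨ cong (suc ∘ length) (filter-none P? none-later) ⟩
  1                               ∎
  where
  open ≡-Reasoning
  P? : ∀ i → Dec (OccursAt t (w₀ ∷ w) i)
  P? = occursAt? t (w₀ ∷ w)
  later : List ℕ
  later = applyUpTo suc (length (w ++ y))
  not-later : ∀ {i} → ¬ OccursAt t (w₀ ∷ w) (suc i)
  not-later {i} occurs with only (take (suc i) t) _ (proj₂ (occursAt⇒split t (w₀ ∷ w) (suc i) occurs))
  ... | ()
  none-later : All (¬_ ∘ OccursAt t (w₀ ∷ w)) later
  none-later = applyUpTo⁺₁ suc (length (w ++ y)) λ {i} _ → not-later {i}

isNet-intro : ∀ t s e → 2 ≤ occ t (substr t s e) →
              (s ≡ 0 ⊎ ∃[ s′ ] s ≡ suc s′ × occ t (substr t s′ e) ≡ 1) →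
              (suc e ≡ length t ⊎ occ t (substr t s (suc e)) ≡ 1) →
              isNet t s e ≡ true
isNet-intro t zero e repeated _ right =
  to T-≡ (from T-∧ (≤⇒≤ᵇ repeated , from T-∧ (_ , from T-∨ (Sum.map (≡⇒≡ᵇ _ _) (≡⇒≡ᵇ _ _) right))))
isNet-intro t (suc s) e repeated (inj₂ (s , refl , once)) right =
  to T-≡ (from T-∧ (≤⇒≤ᵇ repeated ,
          from T-∧ (≡⇒≡ᵇ _ _ once , from T-∨ (Sum.map (≡⇒≡ᵇ _ _) (≡⇒≡ᵇ _ _) right))))

isNet⇒∈netStrings : ∀ t s e → s ≤ e → e < length t → isNet t s e ≡ true → substr t s e ∈ netStrings t
isNet⇒∈netStrings t s e s≤e e< net =
  ∈-deduplicate⁺ (≡-dec _≟S_) (∈-map⁺ (λ p → substr t (proj₁ p) (proj₂ p))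
    (∈-concatMap⁺ _ (lose (∈-upTo⁺ (≤-<-trans s≤e e<)) (∈-concatMap⁺ _ (lose (∈-upTo⁺ e<) selected)))))
  where
  selected : (s , e) ∈ (if (s ≤ᵇ e) ∧ isNet t s e then (s , e) ∷ [] else [])
  selected rewrite to T-≡ (≤⇒≤ᵇ s≤e) | net = here refl

net-prefix : ∀ {t} r₀ r c rest → t ≡ (r₀ ∷ r) ++ c ∷ rest → 2 ≤ occ t (r₀ ∷ r) →
             OnlyAtStart t ((r₀ ∷ r) ++ c ∷ []) → r₀ ∷ r ∈ netStrings t
net-prefix {t} r₀ r c rest refl repeated only =
  subst (_∈ netStrings t) prefix≡ (isNet⇒∈netStrings t 0 (length r) z≤n (s≤s (length-++-≤ˡ r))
    (isNet-intro t 0 (length r) (subst (λ w → 2 ≤ occ t w) (sym prefix≡) repeated) (inj₁ refl) (inj₂ once)))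
  where
  prefix≡ : substr t 0 (length r) ≡ r₀ ∷ r
  prefix≡ = take-length-++ (r₀ ∷ r) (c ∷ rest)
  once : occ t (substr t 0 (suc (length r))) ≡ 1
  once = trans (cong (occ t) (take-suc-length-++ (r₀ ∷ r) c rest))
               (occ≡1 rest (sym (∷ʳ-++ (r₀ ∷ r) c rest)) only)

net-suffix-at : ∀ t₀ t s → 2 ≤ occ (t₀ ∷ t) (drop s (t₀ ∷ t)) →
                (s ≡ 0 ⊎ ∃[ s′ ] s ≡ suc s′ × occ (t₀ ∷ t) (drop s′ (t₀ ∷ t)) ≡ 1) →
                s ≤ length t → drop s (t₀ ∷ t) ∈ netStrings (t₀ ∷ t)
net-suffix-at t₀ t s repeated left s≤ =
  subst (_∈ netStrings (t₀ ∷ t)) (suffix≡ s) (isNet⇒∈netStrings (t₀ ∷ t) s (length t) s≤ ≤-refl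
    (isNet-intro (t₀ ∷ t) s (length t) (subst (λ w → 2 ≤ occ (t₀ ∷ t) w) (sym (suffix≡ s)) repeated)
      (Sum.map₂ (λ (s′ , s≡ , once) → s′ , s≡ , trans (cong (occ (t₀ ∷ t)) (suffix≡ s′)) once) left)
      (inj₁ refl)))
  where
  suffix≡ : ∀ s → substr (t₀ ∷ t) s (length t) ≡ drop s (t₀ ∷ t)
  suffix≡ s = take-all _ _ (≤-reflexive (length-drop s (t₀ ∷ t)))

net-suffix : ∀ t s → s < length t → 2 ≤ occ t (drop s t) → ∃[ s′ ] s′ ≤ s × drop s′ t ∈ netStrings t
net-suffix (t₀ ∷ t) zero    s< repeated = 0 , z≤n , net-suffix-at t₀ t 0 repeated (inj₁ refl) z≤n
net-suffix (t₀ ∷ t) (suc s) s< repeated with occ (t₀ ∷ t) (drop s (t₀ ∷ t)) ≟ 1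
... | yes once = suc s , ≤-refl , net-suffix-at t₀ t (suc s) repeated (inj₂ (s , refl , once)) (s≤s⁻¹ s<)
... | no ¬once =
  let s′ , s′≤s , net = net-suffix (t₀ ∷ t) s (<⇒≤ s<)
                          (≤∧≢⇒< (1≤occ-suffix (t₀ ∷ t) s (<⇒≤ s<)) (¬once ∘ sym))
  in  s′ , m≤n⇒m≤1+n s′≤s , net

border-N-bound : ∀ (U B r : Text) (c d y x : Sym) →
                 U ≡ r ++ c ∷ d ∷ [] → U ++ B ≡ B ++ r ++ y ∷ x ∷ [] → 0 < length B →
                 r ≢ drop 2 (r ++ y ∷ x ∷ []) → OnlyAtStart (U ++ B) (r ++ c ∷ []) →
                 length (U ++ B) ∸ 2 ≤ N (U ++ B)
border-N-bound _ B [] c d y x _ _ _ aperiodic _ = contradiction refl aperiodic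
border-N-bound _ (b₀ ∷ B′) r@(r₀ ∷ r′) c d y x refl border _ aperiodic only = begin
  length t ∸ 2         ≡⟨ length-t∸2 ⟩
  length r + length B  ≤⟨ +-monoʳ-≤ (length r) B≤S ⟩
  length r + length S  ≤⟨ ∈-∈-≢⇒+≤sum-map length r∈ S∈ r≢S ⟩
  N t                  ∎
  where
  open ≤-Reasoning
  U B t : Text
  U = r ++ c ∷ d ∷ []
  B = b₀ ∷ B′
  t = U ++ B

  length-t : length t ≡ length B + (length r + 2)
  length-t = trans (cong length border) (trans (length-++ B) (cong (length B +_) (length-++ r)))

  length-t∸2 : length t ∸ 2 ≡ length r + length B
  length-t∸2 = trans (cong (_∸ 2) length-t)
                 (trans (+-∸-assoc (length B) (m≤n+m 2 (length r)))
                   (trans (cong (length B +_) (m+n∸n≡m (length r) 2)) (+-comm (length B) (length r))))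

  r∈ : r ∈ netStrings t
  r∈ = net-prefix r₀ r′ c (d ∷ B) (++-assoc r (c ∷ d ∷ []) B)
         (2≤occ [] (c ∷ d ∷ B) B (y ∷ x ∷ []) (++-assoc r (c ∷ d ∷ []) B) border λ ()) only

  drop-U : drop (length U) t ≡ B
  drop-U = drop-length-++ U B

  B-repeated : 2 ≤ occ t (drop (length U) t)
  B-repeated = subst (λ w → 2 ≤ occ t w) (sym drop-U)
                 (2≤occ [] (r ++ y ∷ x ∷ []) U [] border (cong (U ++_) (sym (++-identityʳ B))) λ ())

  U<t : length U < length t
  U<t = length-<-++ U b₀ B′

  suffix : ∃[ s ] s ≤ length U × drop s t ∈ netStrings t
  suffix = net-suffix t (length U) U<t B-repeated

  s : ℕ
  s = proj₁ suffix
  S : Text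
  S = drop s t

  s≤U : s ≤ length U
  s≤U = proj₁ (proj₂ suffix)

  S∈ : S ∈ netStrings t
  S∈ = proj₂ (proj₂ suffix)

  B≤S : length B ≤ length S
  B≤S = begin
    length B                  ≡⟨ cong length drop-U ⟨
    length (drop (length U) t) ≡⟨ length-drop (length U) t ⟩
    length t ∸ length U        ≤⟨ ∸-monoʳ-≤ (length t) s≤U ⟩
    length t ∸ s               ≡⟨ length-drop s t ⟨
    length S                   ∎

  r≢S : r ≢ S
  r≢S r≡S = aperiodic (drop-≡⇒periodic B r (y ∷ x ∷ []) s border (≤-trans s≤U (<⇒≤ U<t)) r≡S)

φ : Text → Text
φ []      = []
φ (a ∷ w) = a ∷ b ∷ φ w
φ (b ∷ w) = a ∷ φ w

φ-++ : ∀ u v → φ (u ++ v) ≡ φ u ++ φ v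
φ-++ []      v = refl
φ-++ (a ∷ u) v = cong (λ w → a ∷ b ∷ w) (φ-++ u v)
φ-++ (b ∷ u) v = cong (a ∷_) (φ-++ u v)

φ-F : ∀ k → φ (F (suc k)) ≡ F (suc (suc k))
φ-F zero          = refl
φ-F (suc zero)    = refl
φ-F (suc (suc k)) = trans (φ-++ (F (2 + k)) (F (1 + k))) (cong₂ _++_ (φ-F (suc k)) (φ-F k))

φ≢b∷ : ∀ u z → φ u ≢ b ∷ z
φ≢b∷ []      z ()
φ≢b∷ (a ∷ u) z ()
φ≢b∷ (b ∷ u) z ()

φ-++-a∷ : ∀ v y → ∃[ z ] φ v ++ a ∷ y ≡ a ∷ z
φ-++-a∷ []      y = y , refl
φ-++-a∷ (a ∷ v) y = _ , refl
φ-++-a∷ (b ∷ v) y = _ , refl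

φ-split : ∀ u x z → φ u ≡ x ++ a ∷ z → ∃[ u₁ ] ∃[ u₂ ] u ≡ u₁ ++ u₂ × φ u₁ ≡ x × φ u₂ ≡ a ∷ z
φ-split u       []          z eq = [] , u , refl , refl , eq
φ-split (a ∷ u) (a ∷ b ∷ x) z eq with φ-split u x z (∷-injectiveʳ (∷-injectiveʳ eq))
... | u₁ , u₂ , refl , refl , φu₂ = a ∷ u₁ , u₂ , refl , refl , φu₂
φ-split (b ∷ u) (a ∷ x)     z eq with φ-split u x z (∷-injectiveʳ eq)
... | u₁ , u₂ , refl , refl , φu₂ = b ∷ u₁ , u₂ , refl , refl , φu₂
φ-split []      (_ ∷ _)     z ()
φ-split (a ∷ u) (a ∷ [])    z ()
φ-split (a ∷ u) (a ∷ a ∷ x) z ()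
φ-split (a ∷ u) (b ∷ x)     z ()
φ-split (b ∷ u) (b ∷ x)     z ()

φ-cancelˡ : ∀ v u y → φ u ≡ φ v ++ a ∷ y → ∃[ u′ ] u ≡ v ++ u′ × φ u′ ≡ a ∷ y
φ-cancelˡ []      u       y eq = u , refl , eq
φ-cancelˡ (a ∷ v) (a ∷ u) y eq with φ-cancelˡ v u y (∷-injectiveʳ (∷-injectiveʳ eq))
... | u′ , refl , φu′ = u′ , refl , φu′
φ-cancelˡ (b ∷ v) (b ∷ u) y eq with φ-cancelˡ v u y (∷-injectiveʳ eq)
... | u′ , refl , φu′ = u′ , refl , φu′
φ-cancelˡ (a ∷ v) (b ∷ u) y eq = contradiction (∷-injectiveʳ eq) (φ≢b∷ u _)
φ-cancelˡ (b ∷ v) (a ∷ u) y eq with φ-++-a∷ v y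
... | z , eq′ with () ← trans (∷-injectiveʳ eq) eq′
φ-cancelˡ (a ∷ v) []      y ()
φ-cancelˡ (b ∷ v) []      y ()

φ-desubstitute : ∀ u x v y → φ u ≡ x ++ φ v ++ a ∷ y →
                 ∃[ u₁ ] ∃[ u₂ ] u ≡ u₁ ++ v ++ u₂ × φ u₁ ≡ x × φ u₂ ≡ a ∷ y
φ-desubstitute u x v y eq with φ-++-a∷ v y
... | z , starts-a with φ-split u x z (trans eq (cong (x ++_) starts-a))
... | u₁ , u′ , refl , φu₁ , φu′ with φ-cancelˡ v u′ y (trans φu′ (sym starts-a))
... | u₂ , refl , φu₂ = u₁ , u₂ , refl , φu₁ , φu₂

φ-onlyAtStart : ∀ {t} w → OnlyAtStart t w → OnlyAtStart (φ t) (φ w ++ a ∷ [])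
φ-onlyAtStart {t} w only x y eq
  with φ-desubstitute t x w y (trans eq (cong (x ++_) (++-assoc (φ w) (a ∷ []) y)))
... | u₁ , u₂ , t≡ , refl , _ = cong φ (only u₁ u₂ t≡)

φ-onlyAtStart-a : ∀ {t} w → OnlyAtStart t (w ++ a ∷ []) → OnlyAtStart (φ t) (φ w ++ a ∷ b ∷ [])
φ-onlyAtStart-a {t} w only x y eq
  with φ-desubstitute t x w (b ∷ y) (trans eq (cong (x ++_) (++-assoc (φ w) (a ∷ b ∷ []) y)))
... | u₁ , a ∷ u₂ , t≡ , refl , _ = cong φ (only u₁ u₂ (trans t≡ (cong (u₁ ++_) (sym (∷ʳ-++ w a u₂)))))
... | u₁ , b ∷ u₂ , _  , _    , φu₂ = contradiction (∷-injectiveʳ φu₂) (φ≢b∷ u₂ y)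
... | u₁ , []     , _  , _    , ()

other : Sym → Sym
other a = b
other b = a

InitOnlyAtStart : Text → Text → Set
InitOnlyAtStart u t = ∃[ r ] ∃[ c ] u ≡ r ++ c ∷ other c ∷ [] × OnlyAtStart t (r ++ c ∷ [])

φ-ending : ∀ r c → φ (r ++ c ∷ other c ∷ []) ≡ (φ r ++ a ∷ []) ++ other c ∷ c ∷ []
φ-ending r a = trans (φ-++ r (a ∷ b ∷ [])) (sym (++-assoc (φ r) (a ∷ []) (b ∷ a ∷ [])))
φ-ending r b = trans (φ-++ r (b ∷ a ∷ [])) (sym (++-assoc (φ r) (a ∷ []) (a ∷ b ∷ [])))

φ-initOnlyAtStart : ∀ {u t} → InitOnlyAtStart u t → InitOnlyAtStart (φ u) (φ t)
φ-initOnlyAtStart (r , a , refl , only) =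
  φ r ++ a ∷ [] , b , φ-ending r a ,
  subst (OnlyAtStart _) (sym (++-assoc (φ r) (a ∷ []) (b ∷ []))) (φ-onlyAtStart-a r only)
φ-initOnlyAtStart (r , b , refl , only) =
  φ r ++ a ∷ [] , a , φ-ending r b ,
  subst (OnlyAtStart _) (cong (_++ a ∷ []) (φ-++ r (b ∷ []))) (φ-onlyAtStart (r ++ b ∷ []) only)

abaa-onlyAtStart-F₆ : OnlyAtStart (F 6) (a ∷ b ∷ a ∷ a ∷ [])
abaa-onlyAtStart-F₆ []                                    _ _  = refl
abaa-onlyAtStart-F₆ (_ ∷ [])                              _ ()
abaa-onlyAtStart-F₆ (_ ∷ _ ∷ [])                          _ ()
abaa-onlyAtStart-F₆ (_ ∷ _ ∷ _ ∷ [])                      _ ()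
abaa-onlyAtStart-F₆ (_ ∷ _ ∷ _ ∷ _ ∷ [])                  _ ()
abaa-onlyAtStart-F₆ (_ ∷ _ ∷ _ ∷ _ ∷ _ ∷ [])              _ ()
abaa-onlyAtStart-F₆ (_ ∷ _ ∷ _ ∷ _ ∷ _ ∷ _ ∷ [])          _ ()
abaa-onlyAtStart-F₆ (_ ∷ _ ∷ _ ∷ _ ∷ _ ∷ _ ∷ _ ∷ [])      _ ()
abaa-onlyAtStart-F₆ (_ ∷ _ ∷ _ ∷ _ ∷ _ ∷ _ ∷ _ ∷ _ ∷ [])  _ ()
abaa-onlyAtStart-F₆ (_ ∷ _ ∷ _ ∷ _ ∷ _ ∷ _ ∷ _ ∷ _ ∷ _ ∷ _) _ ()

F-initOnlyAtStart : ∀ k → InitOnlyAtStart (F (5 + k)) (F (6 + k))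
F-initOnlyAtStart zero    = a ∷ b ∷ a ∷ [] , a , refl , abaa-onlyAtStart-F₆
F-initOnlyAtStart (suc k) =
  subst₂ InitOnlyAtStart (φ-F (4 + k)) (φ-F (5 + k)) (φ-initOnlyAtStart (F-initOnlyAtStart k))

F-almost-commute : ∀ k → ∃[ z ] ∃[ x ] ∃[ y ]
                   F (2 + k) ++ F (1 + k) ≡ z ++ x ∷ y ∷ [] × F (1 + k) ++ F (2 + k) ≡ z ++ y ∷ x ∷ []
F-almost-commute zero    = [] , a , b , refl , refl
F-almost-commute (suc k) with F-almost-commute k
... | z , x , y , FF≡ , FF′≡ =
  F (2 + k) ++ z , y , x ,
  trans (++-assoc (F (2 + k)) (F (1 + k)) (F (2 + k)))
        (trans (cong (F (2 + k) ++_) FF′≡) (sym (++-assoc (F (2 + k)) z (y ∷ x ∷ [])))) ,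
  trans (cong (F (2 + k) ++_) FF≡) (sym (++-assoc (F (2 + k)) z (x ∷ y ∷ [])))

F-starts-abaaba : ∀ j → ∃[ q ] F (6 + j) ≡ a ∷ b ∷ a ∷ a ∷ b ∷ a ∷ q
F-starts-abaaba zero    = _ , refl
F-starts-abaaba (suc j) = let q , F≡ = F-starts-abaaba j in q ++ F (5 + j) , cong (_++ F (5 + j)) F≡

abaaba-init₂-aperiodic : ∀ r (c d : Sym) q y x → r ++ c ∷ d ∷ [] ≡ a ∷ b ∷ a ∷ a ∷ b ∷ a ∷ q →
                         r ≢ drop 2 (r ++ y ∷ x ∷ [])
abaaba-init₂-aperiodic []                 _ _ _ _ _ ()
abaaba-init₂-aperiodic (_ ∷ [])           _ _ _ _ _ ()
abaaba-init₂-aperiodic (_ ∷ _ ∷ [])       _ _ _ _ _ ()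
abaaba-init₂-aperiodic (_ ∷ _ ∷ _ ∷ [])   _ _ _ _ _ ()
abaaba-init₂-aperiodic (_ ∷ _ ∷ _ ∷ _ ∷ _) _ _ _ _ _ eq with cong (take 4) eq
... | refl = λ ()

suc≤length-F : ∀ k → suc k ≤ length (F (2 + k))
suc≤length-F zero          = s≤s z≤n
suc≤length-F (suc zero)    = s≤s (s≤s z≤n)
suc≤length-F (suc (suc k)) = begin
  3 + k                                    ≡⟨ +-comm 1 (2 + k) ⟩
  2 + k + 1                                ≤⟨ +-mono-≤ (suc≤length-F (suc k)) (≤-trans (s≤s z≤n) (suc≤length-F k)) ⟩
  length (F (3 + k)) + length (F (2 + k))  ≡⟨ length-++ (F (3 + k)) ⟨
  length (F (4 + k))                       ∎
  where open ≤-Reasoning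

F-N-bound : ∀ j → length (F (7 + j)) ∸ 2 ≤ N (F (7 + j))
F-N-bound j with F-initOnlyAtStart (1 + j) | F-almost-commute (3 + j) | F-starts-abaaba j
... | r , c , F≡ , only | z , x , y , BC≡ , CB≡ | q , F≡′ =
  border-N-bound (F (6 + j)) B r c (other c) y x F≡ border (≤-trans (s≤s z≤n) (suc≤length-F (3 + j)))
    (abaaba-init₂-aperiodic r c (other c) q y x (trans (sym F≡) F≡′)) only
  where
  open ≡-Reasoning
  B C : Text
  B = F (5 + j)
  C = F (4 + j)
  z≡r : z ≡ r
  z≡r = ++-∷-∷-injectiveˡ z r (trans (sym BC≡) F≡)
  border : F (6 + j) ++ B ≡ B ++ r ++ y ∷ x ∷ []
  border = begin
    (B ++ C) ++ B         ≡⟨ ++-assoc B C B ⟩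
    B ++ C ++ B           ≡⟨ cong (B ++_) CB≡ ⟩
    B ++ z ++ y ∷ x ∷ []  ≡⟨ cong (λ w → B ++ w ++ y ∷ x ∷ []) z≡r ⟩
    B ++ r ++ y ∷ x ∷ []  ∎

n≤2[n∸2] : ∀ n → 4 ≤ n → n ≤ 2 * (n ∸ 2)
n≤2[n∸2] (suc (suc n)) (s≤s (s≤s 2≤n)) =
  subst (2 + n ≤_) (cong (n +_) (sym (+-identityʳ n))) (+-monoˡ-≤ n 2≤n)

lemma23 : ((i : ℕ) → 7 ≤ i → length (F i) ∸ 2 ≤ N (F i))
          × Σ ℕ (λ p → Σ ℕ (λ q → 0 < p × 0 < q
              × ((m : ℕ) → Σ Text (λ T → m ≤ length T × p * length T ≤ q * N T))))
lemma23 = F-N-bound′ , 1 , 2 , z<s , z<s , λ m → F (7 + m) , m≤length m , linear m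
  where
  open ≤-Reasoning
  F-N-bound′ : (i : ℕ) → 7 ≤ i → length (F i) ∸ 2 ≤ N (F i)
  F-N-bound′ .(7 + j) (s≤s (s≤s (s≤s (s≤s (s≤s (s≤s (s≤s {n = j} z≤n))))))) = F-N-bound j
  6+m≤length : ∀ m → 6 + m ≤ length (F (7 + m))
  6+m≤length m = suc≤length-F (5 + m)
  m≤length : ∀ m → m ≤ length (F (7 + m))
  m≤length m = ≤-trans (m≤n+m m 6) (6+m≤length m)
  linear : ∀ m → 1 * length (F (7 + m)) ≤ 2 * N (F (7 + m))
  linear m = begin
    1 * length (F (7 + m))        ≡⟨ *-identityˡ _ ⟩
    length (F (7 + m))            ≤⟨ n≤2[n∸2] _ (≤-trans (m≤m+n 4 (2 + m)) (6+m≤length m)) ⟩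
    2 * (length (F (7 + m)) ∸ 2)  ≤⟨ *-monoʳ-≤ 2 (F-N-bound m) ⟩
    2 * N (F (7 + m))             ∎
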